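{- Let $\mathcal{K}$ be the axiom system of $\mathbb{PCL}$ or of any of its extensions, and let $X$ be a maximal $\mathcal{K}$-consistent set of formulas. The relation $\leq_X$ on formulas is reflexive and transitive.
   Context: Formulas are built from atoms and $\bot$ by $\wedge,\vee,\rightarrow$ and a binary conditional $>$. The axiom system of $\mathbb{PCL}$ consists of classical propositional tautologies, modus ponens, the rules (RCEA) from $A\leftrightarrow B$ infer $(A>C)\leftrightarrow(B>C)$ and (RCK) from $A\rightarrow B$ infer $(C>A)\rightarrow(C>B)$, and the axioms (ID) $A>A$, (R-And) $(A>B)\wedge(A>C)\rightarrow(A>(B\wedge C))$, (CM) $(A>B)\wedge(A>C)\rightarrow((A\wedge B)>C)$, (OR) $(A>C)\wedge(B>C)\rightarrow((A\vee B)>C)$; its extensions add some of the axioms (N) $\neg(\top>\bot)$, (T) $A\rightarrow\neg(A>\bot)$, (W) $(A>B)\rightarrow(A\rightarrow B)$, (C) $(A\wedge B)\rightarrow(A>B)$, (U$_1$) $(\neg A>\bot)\rightarrow(\neg(\neg A>\bot)>\bot)$, (U$_2$) $\neg(A>\bot)\rightarrow((A>\bot)>\bot)$, (A$_1$) $(A>B)\rightarrow(C>(A>B))$, (A$_2$) $\neg(A>B)\rightarrow(C>\neg(A>B))$ (here $\neg A := A\rightarrow\bot$, $\top:=\neg\bot$). A set $S$ is $\mathcal{K}$-inconsistent if some finite $\{B_1,\dots,B_n\}\subseteq S$ has $\vdash_{\mathcal{K}}(B_1\wedge\dots\wedge B_n)\rightarrow\bot$; consistent otherwise; maximal consistent if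 consistent and no proper extension by a formula is consistent. For a maximal consistent $X$, define $A\leq_X B$ iff $(A\vee B)>A\in X$. -}

module Defs where

open import Data.Nat using (ℕ)
open import Data.Bool using (Bool; true; false; _∧_; _∨_; not)
open import Data.List using (List; []; _∷_)
open import Data.List.Relation.Unary.All using (All)
open import Data.Product using (Σ; _×_; ∃-syntax)
open import Data.Sum using (_⊎_)
open import Relation.Binary.PropositionalEquality using (_≡_)
open import Relation.Nullary using (¬_)

infixr 6 _∧′_
infixr 5 _∨′_
infixr 4 _⇒_
infixr 7 _>_

data Formula : Set where
  atom  : ℕ → Formula
  ⊥′    : Formula
  _∧′_  : Formula → Formula → Formula
  _∨′_  : Formula → Formula → Formula
  _⇒_   : Formula → Formula → Formula
  _>_   : Formula → Formula → Formula

¬′_ : Formula → Formula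
¬′ A = A ⇒ ⊥′

⊤′ : Formula
⊤′ = ¬′ ⊥′

_⇔_ : Formula → Formula → Formula
A ⇔ B = (A ⇒ B) ∧′ (B ⇒ A)

-- Classical propositional tautologies (in the conditional language):
-- atoms and conditional formulas A > B are treated as propositional
-- variables, whose truth values are given by an arbitrary valuation v.
eval : (Formula → Bool) → Formula → Bool
eval v (atom p) = v (atom p)
eval v ⊥′ = false
eval v (A ∧′ B) = eval v A ∧ eval v B
eval v (A ∨′ B) = eval v A ∨ eval v B
eval v (A ⇒ B) = not (eval v A) ∨ eval v B
eval v (A > B) = v (A > B)

Tautology : Formula → Set
Tautology A = (v : Formula → Bool) → eval v A ≡ true

data ExtAx : Set where
  axN axT axW axC axU₁ axU₂ axA₁ axA₂ : ExtAx

-- An axiom system 𝒦 is PCL plus the extension axioms ax with E ax ≡ true.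
-- (E = λ _ → false gives PCL itself.)
data _⊢_ (E : ExtAx → Bool) : Formula → Set where
  taut : ∀ {A} → Tautology A → E ⊢ A
  mp   : ∀ {A B} → E ⊢ (A ⇒ B) → E ⊢ A → E ⊢ B
  rcea : ∀ {A B C} → E ⊢ (A ⇔ B) → E ⊢ ((A > C) ⇔ (B > C))
  rck  : ∀ {A B C} → E ⊢ (A ⇒ B) → E ⊢ ((C > A) ⇒ (C > B))
  id   : ∀ {A} → E ⊢ (A > A)
  rAnd : ∀ {A B C} → E ⊢ (((A > B) ∧′ (A > C)) ⇒ (A > (B ∧′ C)))
  cm   : ∀ {A B C} → E ⊢ (((A > B) ∧′ (A > C)) ⇒ ((A ∧′ B) > C))
  or   : ∀ {A B C} → E ⊢ (((A > C) ∧′ (B > C)) ⇒ ((A ∨′ B) > C))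
  n    : E axN ≡ true → E ⊢ (¬′ (⊤′ > ⊥′))
  t    : ∀ {A} → E axT ≡ true → E ⊢ (A ⇒ ¬′ (A > ⊥′))
  w    : ∀ {A B} → E axW ≡ true → E ⊢ ((A > B) ⇒ (A ⇒ B))
  c    : ∀ {A B} → E axC ≡ true → E ⊢ ((A ∧′ B) ⇒ (A > B))
  u₁   : ∀ {A} → E axU₁ ≡ true →
         E ⊢ (((¬′ A) > ⊥′) ⇒ ((¬′ ((¬′ A) > ⊥′)) > ⊥′))
  u₂   : ∀ {A} → E axU₂ ≡ true → E ⊢ ((¬′ (A > ⊥′)) ⇒ ((A > ⊥′) > ⊥′))
  a₁   : ∀ {A B C} → E axA₁ ≡ true → E ⊢ ((A > B) ⇒ (C > (A > B)))
  a₂   : ∀ {A B C} → E axA₂ ≡ true → E ⊢ ((¬′ (A > B)) ⇒ (C > (¬′ (A > B))))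

FSet : Set₁
FSet = Formula → Set

conj : Formula → List Formula → Formula
conj B [] = B
conj B (C ∷ Cs) = B ∧′ conj C Cs

Inconsistent : (ExtAx → Bool) → FSet → Set
Inconsistent E S =
  Σ Formula λ B → Σ (List Formula) λ Bs →
    S B × All S Bs × (E ⊢ (conj B Bs ⇒ ⊥′))

Consistent : (ExtAx → Bool) → FSet → Set
Consistent E S = ¬ Inconsistent E S

_∪｛_｝ : FSet → Formula → FSet
(S ∪｛ A ｝) B = S B ⊎ B ≡ A

MaximalConsistent : (ExtAx → Bool) → FSet → Set
MaximalConsistent E X =
  Consistent E X × ((A : Formula) → Consistent E (X ∪｛ A ｝) → X A)

_≤[_]_ : Formula → FSet → Formula → Set
A ≤[ X ] B = X ((A ∨′ B) > A)

-- Reflexivity of ≤_X is (ID) transported along A ↔ A ∨ A by (RCEA).  For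
-- transitivity, from (A ∨ B) > A and (B ∨ C) > B one gets D > (A ∨ B) by (OR),
-- where D = (A ∨ B) ∨ (B ∨ C); cumulative transitivity (CUT, derivable from
-- ID, RCK, OR, R-And and RCEA) then gives D > A, and (CM) turns D > A and
-- D > (A ∨ C) into (A ∨ C) > A.  This uses only that X contains the theorems
-- of 𝒦 and is closed under modus ponens, which holds for maximal consistent
-- sets because 𝒦 is consistent: reading > as material implication turns
-- every theorem into a classical tautology.
module Submission where

open import Defs
open import Data.Bool using (Bool; true; false; _∧_; _∨_; not; T)
open import Data.Bool.Properties using (T-∧; T-≡)
open import Data.Fin using (Fin; zero; suc)
open import Data.List using (List; []; _∷_; _++_)
open import Data.List.Relation.Unary.All using (All; []; _∷_)
open import Data.List.Relation.Unary.All.Properties using (++⁺; ++⁻)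
open import Data.Nat using (ℕ; zero; suc)
open import Data.Product as Product using (_×_; _,_; proj₁; proj₂)
open import Data.Sum using (inj₁; inj₂)
open import Data.Vec using (Vec; []; _∷_; lookup; map)
open import Data.Vec.Properties using (lookup-map)
open import Function using (_∘_)
open import Function.Bundles using (Equivalence)
open import Relation.Binary.PropositionalEquality using (_≡_; refl; sym; cong₂; trans)
open import Relation.Nullary using (¬_)

private
  variable
    E : ExtAx → Bool
    X : FSet
    m : ℕ
    v : Formula → Bool
    A B C R : Formula
    Γ : List Formula

record _⊨_ (v : Formula → Bool) (A : Formula) : Set where
  constructor holds
  field truth : eval v A ≡ true
open _⊨_

⊨-⇒⁺ : (v ⊨ A → v ⊨ B) → v ⊨ (A ⇒ B)
⊨-⇒⁺ {v} {A} {B} f = holds (implication (eval v A) (λ a → truth (f (holds a))))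
  where
  implication : ∀ a → (a ≡ true → eval v B ≡ true) → not a ∨ eval v B ≡ true
  implication true  g = g refl
  implication false _ = refl

⊨-⇒⁻ : v ⊨ (A ⇒ B) → v ⊨ A → v ⊨ B
⊨-⇒⁻ {v} {A} (holds h) (holds a) with eval v A
⊨-⇒⁻ (holds h) (holds refl) | true = holds h

⊨-∧⁺ : v ⊨ A → v ⊨ B → v ⊨ (A ∧′ B)
⊨-∧⁺ (holds a) (holds b) = holds (cong₂ _∧_ a b)

⊨-∧⁻ : v ⊨ (A ∧′ B) → v ⊨ A × v ⊨ B
⊨-∧⁻ {v} {A} {B} (holds h) = Product.map holds holds (conjuncts (eval v A) h)
  where
  conjuncts : ∀ a {b} → a ∧ b ≡ true → a ≡ true × b ≡ true
  conjuncts true h = refl , h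

-- Reusing conj makes a witness of Inconsistent E X literally a derivation of
-- ⋀ Γ ⇒ ⊥′ for a nonempty Γ ⊆ X.
⋀ : List Formula → Formula
⋀ []       = ⊤′
⋀ (B ∷ Bs) = conj B Bs

⊨-⋀⁺ : All (v ⊨_) Γ → v ⊨ ⋀ Γ
⊨-⋀⁺ []               = holds refl
⊨-⋀⁺ (b ∷ [])         = b
⊨-⋀⁺ (b ∷ bs@(_ ∷ _)) = ⊨-∧⁺ b (⊨-⋀⁺ bs)

⊨-⋀⁻ : ∀ Γ → v ⊨ ⋀ Γ → All (v ⊨_) Γ
⊨-⋀⁻ []           _ = []
⊨-⋀⁻ (B ∷ [])     h = h ∷ []
⊨-⋀⁻ (B ∷ C ∷ Cs) h = proj₁ (⊨-∧⁻ h) ∷ ⊨-⋀⁻ (C ∷ Cs) (proj₂ (⊨-∧⁻ h))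

-- A schema true under all 2^m
-- assignments has only tautologies as instances P ⟨ As ⟩; for a closed schema
-- the argument T (valid ⟦ P ⟧) evaluates to ⊤ and is filled in automatically.
infixr 6 _∧ₛ_
infixr 5 _∨ₛ_
infixr 4 _⇒ₛ_ _⇔ₛ_

data Schema (m : ℕ) : Set where
  var  : Fin m → Schema m
  ⊥ₛ   : Schema m
  _∧ₛ_ : Schema m → Schema m → Schema m
  _∨ₛ_ : Schema m → Schema m → Schema m
  _⇒ₛ_ : Schema m → Schema m → Schema m

¬ₛ_ : Schema m → Schema m
¬ₛ P = P ⇒ₛ ⊥ₛ

⊤ₛ : Schema m
⊤ₛ = ¬ₛ ⊥ₛ

_⇔ₛ_ : Schema m → Schema m → Schema m
P ⇔ₛ Q = (P ⇒ₛ Q) ∧ₛ (Q ⇒ₛ P)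

p : Schema (suc m)
p = var zero

q : Schema (suc (suc m))
q = var (suc zero)

r : Schema (suc (suc (suc m)))
r = var (suc (suc zero))

_⟨_⟩ : Schema m → Vec Formula m → Formula
var i    ⟨ As ⟩ = lookup As i
⊥ₛ       ⟨ As ⟩ = ⊥′
(P ∧ₛ Q) ⟨ As ⟩ = P ⟨ As ⟩ ∧′ Q ⟨ As ⟩
(P ∨ₛ Q) ⟨ As ⟩ = P ⟨ As ⟩ ∨′ Q ⟨ As ⟩
(P ⇒ₛ Q) ⟨ As ⟩ = P ⟨ As ⟩ ⇒ Q ⟨ As ⟩

⟦_⟧ : Schema m → Vec Bool m → Bool
⟦ var i ⟧  bs = lookup bs i
⟦ ⊥ₛ ⟧     bs = false
⟦ P ∧ₛ Q ⟧ bs = ⟦ P ⟧ bs ∧ ⟦ Q ⟧ bs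
⟦ P ∨ₛ Q ⟧ bs = ⟦ P ⟧ bs ∨ ⟦ Q ⟧ bs
⟦ P ⇒ₛ Q ⟧ bs = not (⟦ P ⟧ bs) ∨ ⟦ Q ⟧ bs

eval-⟨⟩ : ∀ v (P : Schema m) As → eval v (P ⟨ As ⟩) ≡ ⟦ P ⟧ (map (eval v) As)
eval-⟨⟩ v (var i)  As = sym (lookup-map i (eval v) As)
eval-⟨⟩ v ⊥ₛ       As = refl
eval-⟨⟩ v (P ∧ₛ Q) As = cong₂ _∧_ (eval-⟨⟩ v P As) (eval-⟨⟩ v Q As)
eval-⟨⟩ v (P ∨ₛ Q) As = cong₂ _∨_ (eval-⟨⟩ v P As) (eval-⟨⟩ v Q As)
eval-⟨⟩ v (P ⇒ₛ Q) As = cong₂ (λ a b → not a ∨ b) (eval-⟨⟩ v P As) (eval-⟨⟩ v Q As)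

valid : (Vec Bool m → Bool) → Bool
valid {zero}  f = f []
valid {suc m} f = valid (f ∘ (true ∷_)) ∧ valid (f ∘ (false ∷_))

valid-sound : (f : Vec Bool m → Bool) → T (valid f) → ∀ bs → f bs ≡ true
valid-sound {zero}  f h []           = Equivalence.to T-≡ h
valid-sound {suc m} f h (true ∷ bs)  = valid-sound _ (proj₁ (Equivalence.to T-∧ h)) bs
valid-sound {suc m} f h (false ∷ bs) = valid-sound _ (proj₂ (Equivalence.to T-∧ h)) bs

⊨-instance : (P : Schema m) {_ : T (valid ⟦ P ⟧)} (As : Vec Formula m) → v ⊨ (P ⟨ As ⟩)
⊨-instance {v = v} P {h} As = holds (trans (eval-⟨⟩ v P As) (valid-sound ⟦ P ⟧ h (map (eval v) As)))

⊢-tautology : (P : Schema m) {_ : T (valid ⟦ P ⟧)} (As : Vec Formula m) → E ⊢ (P ⟨ As ⟩)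
⊢-tautology P {h} As = taut (λ v → truth (⊨-instance P {h} As))

material : Formula → Formula
material (atom i) = atom i
material ⊥′       = ⊥′
material (A ∧′ B) = material A ∧′ material B
material (A ∨′ B) = material A ∨′ material B
material (A ⇒ B)  = material A ⇒ material B
material (A > B)  = material A ⇒ material B

eval-material : ∀ v A → eval v (material A) ≡ eval (eval v ∘ material) A
eval-material v (atom i) = refl
eval-material v ⊥′       = refl
eval-material v (A ∧′ B) = cong₂ _∧_ (eval-material v A) (eval-material v B)
eval-material v (A ∨′ B) = cong₂ _∨_ (eval-material v A) (eval-material v B)
eval-material v (A ⇒ B)  = cong₂ (λ a b → not a ∨ b) (eval-material v A) (eval-material v B)
eval-material v (A > B)  = refl

material-sound : E ⊢ A → ∀ v → v ⊨ material A
material-sound {A = A} (taut τ) v = holds (trans (eval-material v A) (τ (eval v ∘ material)))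
material-sound (mp d e) v = ⊨-⇒⁻ (material-sound d v) (material-sound e v)
material-sound (rcea {A} {B} {C} d) v =
  ⊨-⇒⁻ (⊨-instance ((p ⇔ₛ q) ⇒ₛ ((p ⇒ₛ r) ⇔ₛ (q ⇒ₛ r))) (material A ∷ material B ∷ material C ∷ []))
       (material-sound d v)
material-sound (rck {A} {B} {C} d) v =
  ⊨-⇒⁻ (⊨-instance ((p ⇒ₛ q) ⇒ₛ (r ⇒ₛ p) ⇒ₛ (r ⇒ₛ q)) (material A ∷ material B ∷ material C ∷ []))
       (material-sound d v)
material-sound (id {A}) _ = ⊨-instance (p ⇒ₛ p) (material A ∷ [])
material-sound (rAnd {A} {B} {C}) _ =
  ⊨-instance ((p ⇒ₛ q) ∧ₛ (p ⇒ₛ r) ⇒ₛ p ⇒ₛ q ∧ₛ r) (material A ∷ material B ∷ material C ∷ [])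
material-sound (cm {A} {B} {C}) _ =
  ⊨-instance ((p ⇒ₛ q) ∧ₛ (p ⇒ₛ r) ⇒ₛ p ∧ₛ q ⇒ₛ r) (material A ∷ material B ∷ material C ∷ [])
material-sound (or {A} {B} {C}) _ =
  ⊨-instance ((p ⇒ₛ r) ∧ₛ (q ⇒ₛ r) ⇒ₛ p ∨ₛ q ⇒ₛ r) (material A ∷ material B ∷ material C ∷ [])
material-sound (n _) _ = ⊨-instance (¬ₛ (⊤ₛ ⇒ₛ ⊥ₛ)) []
material-sound (t {A} _) _ = ⊨-instance (p ⇒ₛ ¬ₛ (p ⇒ₛ ⊥ₛ)) (material A ∷ [])
material-sound (w {A} {B} _) _ = ⊨-instance ((p ⇒ₛ q) ⇒ₛ p ⇒ₛ q) (material A ∷ material B ∷ [])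
material-sound (c {A} {B} _) _ = ⊨-instance (p ∧ₛ q ⇒ₛ p ⇒ₛ q) (material A ∷ material B ∷ [])
material-sound (u₁ {A} _) _ =
  ⊨-instance ((¬ₛ p ⇒ₛ ⊥ₛ) ⇒ₛ (¬ₛ (¬ₛ p ⇒ₛ ⊥ₛ) ⇒ₛ ⊥ₛ)) (material A ∷ [])
material-sound (u₂ {A} _) _ = ⊨-instance (¬ₛ (p ⇒ₛ ⊥ₛ) ⇒ₛ ((p ⇒ₛ ⊥ₛ) ⇒ₛ ⊥ₛ)) (material A ∷ [])
material-sound (a₁ {A} {B} {C} _) _ =
  ⊨-instance ((p ⇒ₛ q) ⇒ₛ r ⇒ₛ p ⇒ₛ q) (material A ∷ material B ∷ material C ∷ [])
material-sound (a₂ {A} {B} {C} _) _ =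
  ⊨-instance (¬ₛ (p ⇒ₛ q) ⇒ₛ r ⇒ₛ ¬ₛ (p ⇒ₛ q)) (material A ∷ material B ∷ material C ∷ [])

¬⊢⊤⇒⊥ : ¬ E ⊢ (⊤′ ⇒ ⊥′)
¬⊢⊤⇒⊥ d with truth (material-sound d (λ _ → true))
... | ()

strip : All (X ∪｛ R ｝) Γ → List Formula
strip []                        = []
strip (_∷_ {x = B} (inj₁ _) ps) = B ∷ strip ps
strip (inj₂ _ ∷ ps)             = strip ps

strip-⊆ : (ps : All (X ∪｛ R ｝) Γ) → All X (strip ps)
strip-⊆ []            = []
strip-⊆ (inj₁ s ∷ ps) = s ∷ strip-⊆ ps
strip-⊆ (inj₂ _ ∷ ps) = strip-⊆ ps

strip-All : ∀ {P : Formula → Set} (ps : All (X ∪｛ R ｝) Γ) → All P (strip ps) → P R → All P Γ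
strip-All []               _        _  = []
strip-All (inj₁ _ ∷ ps)    (b ∷ bs) pR = b ∷ strip-All ps bs pR
strip-All (inj₂ refl ∷ ps) bs       pR = pR ∷ strip-All ps bs pR

strip-refutation : ∀ Γ {Δ} (ps : All (X ∪｛ R ｝) Δ) →
                   v ⊨ ((⋀ Γ ⇒ R) ⇒ (⋀ Δ ⇒ ⊥′) ⇒ ⋀ (strip ps ++ Γ) ⇒ ⊥′)
strip-refutation Γ ps = ⊨-⇒⁺ λ Γ⇒R → ⊨-⇒⁺ λ ¬Δ → ⊨-⇒⁺ λ strip++Γ →
  let (⊨strip , ⊨Γ) = ++⁻ (strip ps) (⊨-⋀⁻ _ strip++Γ)
  in ⊨-⇒⁻ ¬Δ (⊨-⋀⁺ (strip-All ps ⊨strip (⊨-⇒⁻ Γ⇒R (⊨-⋀⁺ ⊨Γ))))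

record DeductivelyClosed (E : ExtAx → Bool) (X : FSet) : Set where
  field
    theorem     : ∀ {A} → E ⊢ A → X A
    modusPonens : ∀ {A B} → X (A ⇒ B) → X A → X B

module _ (mc : MaximalConsistent E X) where

  ⋀-unrefutable : All X Γ → ¬ E ⊢ (⋀ Γ ⇒ ⊥′)
  ⋀-unrefutable []         = ¬⊢⊤⇒⊥
  ⋀-unrefutable (b ∷ bs) d = proj₁ mc (_ , _ , b , bs , d)

  -- Dropping the copies of R from a refutation of X ∪ {R} and adding Γ
  -- leaves a refutation of X.
  ⊢-closed : All X Γ → E ⊢ (⋀ Γ ⇒ R) → X R
  ⊢-closed {Γ} {R} XΓ d = proj₂ mc R λ (_ , _ , b , bs , refutation) →
    let ps = b ∷ bs
    in ⋀-unrefutable (++⁺ (strip-⊆ ps) XΓ) (mp (mp (taut λ v → truth (strip-refutation Γ ps)) d) refutation)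

  maximalConsistent⇒deductivelyClosed : DeductivelyClosed E X
  maximalConsistent⇒deductivelyClosed = record
    { theorem     = λ {A} d → ⊢-closed [] (mp (⊢-tautology (p ⇒ₛ ⊤ₛ ⇒ₛ p) (A ∷ [])) d)
    ; modusPonens = λ {A} {B} ab a → ⊢-closed (ab ∷ a ∷ []) (⊢-tautology ((p ⇒ₛ q) ∧ₛ p ⇒ₛ q) (A ∷ B ∷ []))
    }

module _ (dc : DeductivelyClosed E X) where
  open DeductivelyClosed dc

  ∧-intro : X A → X B → X (A ∧′ B)
  ∧-intro {A} {B} a b = modusPonens (modusPonens (theorem (⊢-tautology (p ⇒ₛ q ⇒ₛ p ∧ₛ q) (A ∷ B ∷ []))) a) b

  modusPonens₂ : X ((A ∧′ B) ⇒ C) → X A → X B → X C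
  modusPonens₂ h a b = modusPonens h (∧-intro a b)

  ID : X (A > A)
  ID = theorem id

  RCK : E ⊢ (A ⇒ B) → X (C > A) → X (C > B)
  RCK d = modusPonens (theorem (rck d))

  RCEA : E ⊢ (A ⇔ B) → X (A > C) → X (B > C)
  RCEA {A} {B} {C} d =
    modusPonens (theorem (mp (⊢-tautology (p ∧ₛ q ⇒ₛ p) (((A > C) ⇒ (B > C)) ∷ ((B > C) ⇒ (A > C)) ∷ [])) (rcea d)))

  R-And : X (A > B) → X (A > C) → X (A > (B ∧′ C))
  R-And = modusPonens₂ (theorem rAnd)

  CM : X (A > B) → X (A > C) → X ((A ∧′ B) > C)
  CM = modusPonens₂ (theorem cm)

  OR : X (A > C) → X (B > C) → X ((A ∨′ B) > C)
  OR = modusPonens₂ (theorem or)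

  -- A splits into A ∧ B and A ∧ ¬B; B → C holds in both cases, and A > B then yields C.
  CUT : X (A > B) → X ((A ∧′ B) > C) → X (A > C)
  CUT {A} {B} {C} A>B A∧B>C = RCK (⊢-tautology (p ∧ₛ (p ⇒ₛ q) ⇒ₛ q) (B ∷ C ∷ [])) (R-And A>B A>B⇒C)
    where
    A∧B>B⇒C : X ((A ∧′ B) > (B ⇒ C))
    A∧B>B⇒C = RCK (⊢-tautology (q ⇒ₛ p ⇒ₛ q) (B ∷ C ∷ [])) A∧B>C
    A∧¬B>B⇒C : X ((A ∧′ ¬′ B) > (B ⇒ C))
    A∧¬B>B⇒C = RCK (⊢-tautology (p ∧ₛ ¬ₛ q ⇒ₛ q ⇒ₛ r) (A ∷ B ∷ C ∷ [])) ID
    A>B⇒C : X (A > (B ⇒ C))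
    A>B⇒C = RCEA (⊢-tautology ((p ∧ₛ q) ∨ₛ (p ∧ₛ ¬ₛ q) ⇔ₛ p) (A ∷ B ∷ [])) (OR A∧B>B⇒C A∧¬B>B⇒C)

  ≤-refl : A ≤[ X ] A
  ≤-refl {A} = RCEA (⊢-tautology (p ⇔ₛ p ∨ₛ p) (A ∷ [])) ID

  ≤-trans : A ≤[ X ] B → B ≤[ X ] C → A ≤[ X ] C
  ≤-trans {A} {B} {C} A≤B B≤C =
    RCEA (⊢-tautology (((p ∨ₛ q) ∨ₛ (q ∨ₛ r)) ∧ₛ (p ∨ₛ r) ⇔ₛ p ∨ₛ r) (A ∷ B ∷ C ∷ [])) (CM D>A∨C D>A)
    where
    D : Formula
    D = (A ∨′ B) ∨′ (B ∨′ C)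
    D>A∨B : X (D > (A ∨′ B))
    D>A∨B = OR ID (RCK (⊢-tautology (q ⇒ₛ p ∨ₛ q) (A ∷ B ∷ [])) B≤C)
    D∧A∨B>A : X ((D ∧′ (A ∨′ B)) > A)
    D∧A∨B>A = RCEA (⊢-tautology (p ∨ₛ q ⇔ₛ ((p ∨ₛ q) ∨ₛ (q ∨ₛ r)) ∧ₛ (p ∨ₛ q)) (A ∷ B ∷ C ∷ [])) A≤B
    D>A : X (D > A)
    D>A = CUT D>A∨B D∧A∨B>A
    D>A∨C : X (D > (A ∨′ C))
    D>A∨C = RCK (⊢-tautology (p ⇒ₛ p ∨ₛ q) (A ∷ C ∷ [])) D>A

mainTheorem4 : (E : ExtAx → Bool) (X : FSet) → MaximalConsistent E X →
    ((A : Formula) → A ≤[ X ] A) ×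
    ((A B C : Formula) → A ≤[ X ] B → B ≤[ X ] C → A ≤[ X ] C)
mainTheorem4 E X mc = (λ _ → ≤-refl dc) , (λ _ _ _ → ≤-trans dc)
  where
  dc : DeductivelyClosed E X
  dc = maximalConsistent⇒deductivelyClosed mc
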